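{- Let $g\colon\{1,-1\}^m\to\{1,-1\}$ and $f\colon\{1,-1\}^n\to\{1,-1\}$ form a normal pair. Let $U\subseteq[m]\times[n]$. For $r\in[m]$ let $Y_r=\{s\in[n]:(r,s)\in U\}$, for $s\in[n]$ let $X_s=\{r\in[m]:(r,s)\in U\}$, and let $R_U=\{r\in[m]:(r,y)\in U\text{ for some }y\}$, $S_U=\{s\in[n]:(x,s)\in U\text{ for some }x\}$. Then $$\Big(\sum_{S'\supseteq S_U}\hat f(S')\,\hat g(\emptyset)^{|S'\setminus S_U|}\Big)\prod_{s\in S_U}\hat g(X_s)=\Big(\sum_{R'\supseteq R_U}\hat g(R')\,\hat f(\emptyset)^{|R'\setminus R_U|}\Big)\prod_{r\in R_U}\hat f(Y_r),$$ where sums range over $S'\subseteq[n]$ and $R'\subseteq[m]$.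
   Context: Every $h\colon\{1,-1\}^k\to\{1,-1\}$ has a unique Fourier expansion $h(s)=\sum_{R\subseteq[k]}\hat h(R)\prod_{r\in R}s_r$. With $T=1,F=-1$, a pair $(g,f)$ is a normal pair if: (1) for every $m\times n$ array $(M_{ij})$ with entries in $\{1,-1\}$, $f(g(M_{11},\dots,M_{m1}),\dots,g(M_{1n},\dots,M_{mn}))=g(f(M_{11},\dots,M_{1n}),\dots,f(M_{m1},\dots,M_{mn}))$; (2) every index is relevant for $g$ and for $f$ (flipping that argument alone changes the value at some input); (3) neither $g$ nor $f$ is constant. Convention: $a^0=1$ and empty products equal $1$. -}

module Defs where

open import Data.Bool using (Bool; true; false; not; if_then_else_; _∨_)
open import Data.Nat using (ℕ; zero; suc)
open import Data.Fin using (Fin)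
open import Data.Vec using (Vec; []; _∷_; lookup; tabulate; _[_]%=_)
open import Data.List using (List; []; _∷_; map; _++_; foldr)
open import Data.Rational using (ℚ; 0ℚ; 1ℚ; -_; _+_; _*_; ½)
open import Data.Product using (∃; ∃-syntax; _×_)
open import Data.Fin.Subset using (Subset; _⊆_; _∈_; _─_; ∣_∣)
open import Data.Fin.Subset.Properties using (_⊆?_; _∈?_)
open import Relation.Nullary using (does; ¬_)
open import Relation.Binary.PropositionalEquality using (_≡_)

-- Inputs {1,-1}^k are encoded as Vec Bool k, with true = T = 1, false = F = -1.
Input : ℕ → Set
Input k = Vec Bool k

BFun : ℕ → Set
BFun k = Input k → Bool

allVecs : (k : ℕ) → List (Vec Bool k)
allVecs zero    = [] ∷ []
allVecs (suc k) = map (true ∷_) (allVecs k) ++ map (false ∷_) (allVecs k)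

val : Bool → ℚ
val true  = 1ℚ
val false = - 1ℚ

sumL : {A : Set} → List A → (A → ℚ) → ℚ
sumL xs f = foldr (λ x acc → f x + acc) 0ℚ xs

_^ℚ_ : ℚ → ℕ → ℚ
a ^ℚ zero  = 1ℚ
a ^ℚ suc k = a * (a ^ℚ k)

prodOver : {k : ℕ} → Subset k → (Fin k → ℚ) → ℚ
prodOver {k} R F = foldr _*_ 1ℚ (Data.List.tabulate {n = k} (λ r → if does (r ∈? R) then F r else 1ℚ))

χ : {k : ℕ} → Subset k → Input k → ℚ
χ R x = prodOver R (λ r → val (lookup x r))

fourier : {k : ℕ} → BFun k → Subset k → ℚ
fourier {k} h R = (½ ^ℚ k) * sumL (allVecs k) (λ x → val (h x) * χ R x)

sumSupersets : {k : ℕ} → Subset k → (Subset k → ℚ) → ℚ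
sumSupersets {k} S F = sumL (allVecs k) (λ S′ → if does (S ⊆? S′) then F S′ else 0ℚ)

Relevant : {k : ℕ} → BFun k → Fin k → Set
Relevant h i = ∃[ x ] (¬ (h x ≡ h (x [ i ]%= not)))

NonConstant : {k : ℕ} → BFun k → Set
NonConstant h = ∃[ x ] ∃[ y ] (¬ (h x ≡ h y))

Commute : {m n : ℕ} → BFun m → BFun n → Set
Commute {m} {n} g f = ∀ (M : Fin m → Fin n → Bool) →
  f (tabulate (λ j → g (tabulate (λ i → M i j)))) ≡ g (tabulate (λ i → f (tabulate (λ j → M i j))))

record NormalPair {m n : ℕ} (g : BFun m) (f : BFun n) : Set where
  field
    commute    : Commute g f
    relevant-g : ∀ i → Relevant g i
    relevant-f : ∀ j → Relevant f j
    nonconst-g : NonConstant g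
    nonconst-f : NonConstant f

-- For U ⊆ [m] × [n] given as its indicator U r s:
Yrow : {m n : ℕ} → (Fin m → Fin n → Bool) → Fin m → Subset n
Yrow U r = tabulate (λ s → U r s)

Xcol : {m n : ℕ} → (Fin m → Fin n → Bool) → Fin n → Subset m
Xcol U s = tabulate (λ r → U r s)

anyFin : (k : ℕ) → (Fin k → Bool) → Bool
anyFin k p = foldr _∨_ false (Data.List.tabulate {n = k} p)

RU : {m n : ℕ} → (Fin m → Fin n → Bool) → Subset m
RU {m} {n} U = tabulate (λ r → anyFin n (λ y → U r y))

SU : {m n : ℕ} → (Fin m → Fin n → Bool) → Subset n
SU {m} {n} U = tabulate (λ s → anyFin m (λ x → U x s))

module Submission where

-- Read T, F as 1, -1.  A one-bit functional (a , b) sends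
-- φ : Bool → ℚ to a·φ(T) + b·φ(F); a vector of them acts on functions of
-- Vec Bool k as their tensor product ('apply').  The Fourier coefficient ĥ(R)
-- is 'apply' of the tensor carrying the difference functional ½(T − F) on R
-- and the average ½(T + F) off R.
--
-- Put the difference functional at the cells (r , s) ∈ U of an m × n array
-- and the average elsewhere, and apply this array functional Φ to
-- M ↦ f(g(column₁ M), …, g(columnₙ M)).  Integrating every column first, the
-- cells of column s collapse to one functional on the bit g(column), with
-- total weight [X_s = ∅] and difference ĝ(X_s) ('pushforward').  Expanding
-- what remains in the Fourier basis of f gives Σ_{S'} f̂(S') ∏_s (…), which
-- evaluates to the left-hand side of the theorem ('weight-eval').  The same
-- computation on the transposed array gives the right-hand side as Φ applied
-- to M ↦ g(f(row₁ M), …, f(rowₘ M)); the two integrands agree by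
-- commutation, and Φ may be evaluated rows-first or columns-first (Fubini).

open import Defs
open import Data.Nat using (ℕ; zero; suc)
open import Data.Bool using (Bool; true; false; if_then_else_)
open import Data.Fin using (Fin; zero; suc)
open import Data.Fin.Subset using (Subset; _─_; ∣_∣; ⊥)
open import Data.Fin.Subset.Properties using (_⊆?_)
open import Data.Vec using (Vec; []; _∷_; lookup; tabulate)
import Data.Vec as Vec
open import Data.Vec.Properties using (tabulate∘lookup; lookup∘tabulate; tabulate-cong; tabulate-∘)
open import Data.List using (List; []; _∷_; map; _++_)
open import Data.Rational using (ℚ; 0ℚ; 1ℚ; -_; _+_; _*_; _-_; ½)
open import Data.Rational.Properties using (*-zeroˡ; *-zeroʳ; *-assoc; *-comm; +-identityˡ; +-assoc; *-distribˡ-+)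
open import Data.Rational.Solver using (module +-*-Solver)
open import Data.Product using (_×_; _,_; proj₁; proj₂)
open import Relation.Nullary using (does)
open import Relation.Binary.PropositionalEquality using (_≡_; refl; sym; trans; cong; cong₂; module ≡-Reasoning)
open ≡-Reasoning
open +-*-Solver using (solve; _:=_; _:+_; _:*_; _:-_; con)

Functional : Set
Functional = ℚ × ℚ

apply₁ : Functional → (Bool → ℚ) → ℚ
apply₁ (a , b) φ = a * φ true + b * φ false

apply : ∀ {k} → Vec Functional k → (Vec Bool k → ℚ) → ℚ
apply []      h = h []
apply (ℓ ∷ ψ) h = apply₁ ℓ (λ b → apply ψ (λ x → h (b ∷ x)))

-- 'apply ψ' only depends on the values of its argument (there is no funext).
apply-cong : ∀ {k} (ψ : Vec Functional k) {h h′ : Vec Bool k → ℚ} →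
             (∀ x → h x ≡ h′ x) → apply ψ h ≡ apply ψ h′
apply-cong []            e = e []
apply-cong ((a , b) ∷ ψ) e =
  cong₂ (λ u v → a * u + b * v) (apply-cong ψ (λ x → e (true ∷ x))) (apply-cong ψ (λ x → e (false ∷ x)))

apply-scale : ∀ {k} (ψ : Vec Functional k) (c : ℚ) (h : Vec Bool k → ℚ) →
              apply ψ (λ x → c * h x) ≡ c * apply ψ h
apply-scale []            c h = refl
apply-scale ((a , b) ∷ ψ) c h =
  trans (cong₂ (λ u v → a * u + b * v) (apply-scale ψ c _) (apply-scale ψ c _))
        (solve 5 (λ a b c u v → a :* (c :* u) :+ b :* (c :* v) := c :* (a :* u :+ b :* v)) refl a b c _ _)

apply-+ : ∀ {k} (ψ : Vec Functional k) (h h′ : Vec Bool k → ℚ) →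
          apply ψ (λ x → h x + h′ x) ≡ apply ψ h + apply ψ h′
apply-+ []            h h′ = refl
apply-+ ((a , b) ∷ ψ) h h′ =
  trans (cong₂ (λ u v → a * u + b * v) (apply-+ ψ _ _) (apply-+ ψ _ _))
        (solve 6 (λ a b u u′ v v′ → a :* (u :+ u′) :+ b :* (v :+ v′) := (a :* u :+ b :* v) :+ (a :* u′ :+ b :* v′))
               refl a b _ _ _ _)

apply-swap : ∀ {k k′} (ψ : Vec Functional k) (ψ′ : Vec Functional k′) (h : Vec Bool k → Vec Bool k′ → ℚ) →
             apply ψ (λ x → apply ψ′ (λ y → h x y)) ≡ apply ψ′ (λ y → apply ψ (λ x → h x y))
apply-swap []            ψ′ h = refl
apply-swap ((a , b) ∷ ψ) ψ′ h = begin
  a * apply ψ (λ x → apply ψ′ (h (true ∷ x))) + b * apply ψ (λ x → apply ψ′ (h (false ∷ x)))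
    ≡⟨ cong₂ (λ u v → a * u + b * v) (apply-swap ψ ψ′ _) (apply-swap ψ ψ′ _) ⟩
  a * apply ψ′ (λ y → apply ψ (λ x → h (true ∷ x) y)) + b * apply ψ′ (λ y → apply ψ (λ x → h (false ∷ x) y))
    ≡⟨ cong₂ _+_ (sym (apply-scale ψ′ a _)) (sym (apply-scale ψ′ b _)) ⟩
  apply ψ′ (λ y → a * apply ψ (λ x → h (true ∷ x) y)) + apply ψ′ (λ y → b * apply ψ (λ x → h (false ∷ x) y))
    ≡⟨ sym (apply-+ ψ′ _ _) ⟩
  apply ψ′ (λ y → apply ((a , b) ∷ ψ) (λ x → h x y)) ∎

sumL-++ : ∀ {A : Set} (xs ys : List A) (F : A → ℚ) → sumL (xs ++ ys) F ≡ sumL xs F + sumL ys F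
sumL-++ []       ys F = sym (+-identityˡ _)
sumL-++ (x ∷ xs) ys F = trans (cong (F x +_) (sumL-++ xs ys F)) (sym (+-assoc (F x) _ _))

sumL-map : ∀ {A B : Set} (u : A → B) (xs : List A) (F : B → ℚ) → sumL (map u xs) F ≡ sumL xs (λ x → F (u x))
sumL-map u []       F = refl
sumL-map u (x ∷ xs) F = cong (F (u x) +_) (sumL-map u xs F)

sumL-cong : ∀ {A : Set} (xs : List A) {F F′ : A → ℚ} → (∀ x → F x ≡ F′ x) → sumL xs F ≡ sumL xs F′
sumL-cong []       e = refl
sumL-cong (x ∷ xs) e = cong₂ _+_ (e x) (sumL-cong xs e)

sumL-scaleˡ : ∀ {A : Set} (xs : List A) (c : ℚ) (F : A → ℚ) → c * sumL xs F ≡ sumL xs (λ x → c * F x)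
sumL-scaleˡ []       c F = *-zeroʳ c
sumL-scaleˡ (x ∷ xs) c F = trans (*-distribˡ-+ c (F x) _) (cong (c * F x +_) (sumL-scaleˡ xs c F))

sumL-scaleʳ : ∀ {A : Set} (xs : List A) (c : ℚ) (F : A → ℚ) → sumL xs F * c ≡ sumL xs (λ x → F x * c)
sumL-scaleʳ xs c F =
  trans (*-comm _ c) (trans (sumL-scaleˡ xs c F) (sumL-cong xs (λ x → *-comm c (F x))))

sumL-+ : ∀ {A : Set} (xs : List A) (F F′ : A → ℚ) → sumL xs (λ x → F x + F′ x) ≡ sumL xs F + sumL xs F′
sumL-+ []       F F′ = refl
sumL-+ (x ∷ xs) F F′ = trans (cong (F x + F′ x +_) (sumL-+ xs F F′))
  (solve 4 (λ a b c d → (a :+ b) :+ (c :+ d) := (a :+ c) :+ (b :+ d)) refl (F x) (F′ x) (sumL xs F) (sumL xs F′))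

sum-allVecs-suc : ∀ {k} (F : Vec Bool (suc k) → ℚ) →
  sumL (allVecs (suc k)) F ≡ sumL (allVecs k) (λ x → F (true ∷ x)) + sumL (allVecs k) (λ x → F (false ∷ x))
sum-allVecs-suc {k} F = trans (sumL-++ (map (true ∷_) (allVecs k)) _ F)
  (cong₂ _+_ (sumL-map (true ∷_) (allVecs k) F) (sumL-map (false ∷_) (allVecs k) F))

charFunctional : Bool → Functional
charFunctional true  = ½ , - ½
charFunctional false = ½ , ½

charTensor : ∀ {k} → Subset k → Vec Functional k
charTensor = Vec.map charFunctional

charFactor : Bool → Bool → ℚ
charFactor true  b = val b
charFactor false b = 1ℚ

χ-∷ : ∀ {k} (r : Bool) (R : Subset k) (b : Bool) (x : Input k) → χ (r ∷ R) (b ∷ x) ≡ charFactor r b * χ R x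
χ-∷ true  R b x = refl
χ-∷ false R b x = refl

correlation-apply : ∀ {k} (R : Subset k) (φ : Input k → ℚ) →
  (½ ^ℚ k) * sumL (allVecs k) (λ x → φ x * χ R x) ≡ apply (charTensor R) φ
correlation-apply {zero}  []      φ = solve 1 (λ u → con 1ℚ :* (u :* con 1ℚ :+ con 0ℚ) := u) refl (φ [])
correlation-apply {suc k} (r ∷ R) φ = begin
  (½ * p) * sumL (allVecs (suc k)) (λ x → φ x * χ (r ∷ R) x)
    ≡⟨ cong ((½ * p) *_) (sum-allVecs-suc (λ x → φ x * χ (r ∷ R) x)) ⟩
  (½ * p) * (sumL (allVecs k) (λ x → φ (true ∷ x) * χ (r ∷ R) (true ∷ x))
             + sumL (allVecs k) (λ x → φ (false ∷ x) * χ (r ∷ R) (false ∷ x)))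
    ≡⟨ cong₂ (λ u v → (½ * p) * (u + v)) (factor-out true) (factor-out false) ⟩
  (½ * p) * (charFactor r true * corr true + charFactor r false * corr false)
    ≡⟨ solve 6 (λ h p ct cf a b → (h :* p) :* (ct :* a :+ cf :* b) := (h :* ct) :* (p :* a) :+ (h :* cf) :* (p :* b))
             refl ½ p (charFactor r true) (charFactor r false) (corr true) (corr false) ⟩
  (½ * charFactor r true) * (p * corr true) + (½ * charFactor r false) * (p * corr false)
    ≡⟨ cong₂ (λ u v → (½ * charFactor r true) * u + (½ * charFactor r false) * v)
             (correlation-apply R _) (correlation-apply R _) ⟩
  (½ * charFactor r true) * apply (charTensor R) (λ x → φ (true ∷ x))
    + (½ * charFactor r false) * apply (charTensor R) (λ x → φ (false ∷ x))
    ≡⟨ head-functional r ⟩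
  apply (charTensor (r ∷ R)) φ ∎
  where
  p : ℚ
  p = ½ ^ℚ k
  corr : Bool → ℚ
  corr b = sumL (allVecs k) (λ x → φ (b ∷ x) * χ R x)
  factor-out : ∀ b → sumL (allVecs k) (λ x → φ (b ∷ x) * χ (r ∷ R) (b ∷ x)) ≡ charFactor r b * corr b
  factor-out b = trans
    (sumL-cong (allVecs k) (λ x → trans (cong (φ (b ∷ x) *_) (χ-∷ r R b x))
      (solve 3 (λ u c v → u :* (c :* v) := c :* (u :* v)) refl (φ (b ∷ x)) (charFactor r b) (χ R x))))
    (sym (sumL-scaleˡ (allVecs k) (charFactor r b) (λ x → φ (b ∷ x) * χ R x)))
  head-functional : ∀ r →
    (½ * charFactor r true) * apply (charTensor R) (λ x → φ (true ∷ x))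
      + (½ * charFactor r false) * apply (charTensor R) (λ x → φ (false ∷ x))
    ≡ apply (charTensor (r ∷ R)) φ
  head-functional true  = refl
  head-functional false = refl

fourier-apply : ∀ {k} (h : BFun k) (R : Subset k) → fourier h R ≡ apply (charTensor R) (λ x → val (h x))
fourier-apply h R = correlation-apply R (λ x → val (h x))

total diff : Functional → ℚ
total (a , b) = a + b
diff  (a , b) = a - b

weight : ∀ {k} → Vec Functional k → Subset k → ℚ
weight []      []          = 1ℚ
weight (ℓ ∷ ψ) (true  ∷ S) = diff ℓ * weight ψ S
weight (ℓ ∷ ψ) (false ∷ S) = total ℓ * weight ψ S

-- Fourier expansion of a tensor: ψ(φ) = Σ_S φ̂(S) · weight ψ S, where
-- φ̂(S) = charTensor S applied to φ.  Coordinatewise this is the identity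
-- (a , b) = (a + b)·average + (a − b)·difference.
apply-expansion : ∀ {k} (ψ : Vec Functional k) (φ : Input k → ℚ) →
  apply ψ φ ≡ sumL (allVecs k) (λ S → apply (charTensor S) φ * weight ψ S)
apply-expansion []            φ = solve 1 (λ u → u := u :* con 1ℚ :+ con 0ℚ) refl (φ [])
apply-expansion {suc k} ((a , b) ∷ ψ) φ = sym (begin
  sumL (allVecs (suc k)) (λ S → apply (charTensor S) φ * weight ((a , b) ∷ ψ) S)
    ≡⟨ sum-allVecs-suc (λ S → apply (charTensor S) φ * weight ((a , b) ∷ ψ) S) ⟩
  sumL (allVecs k) (term true) + sumL (allVecs k) (term false)
    ≡⟨ sym (sumL-+ (allVecs k) (term true) (term false)) ⟩
  sumL (allVecs k) (λ S → term true S + term false S)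
    ≡⟨ sumL-cong (allVecs k) regroup ⟩
  sumL (allVecs k) (λ S → a * (coeff true S * weight ψ S) + b * (coeff false S * weight ψ S))
    ≡⟨ sumL-+ (allVecs k) (λ S → a * (coeff true S * weight ψ S)) (λ S → b * (coeff false S * weight ψ S)) ⟩
  sumL (allVecs k) (λ S → a * (coeff true S * weight ψ S)) + sumL (allVecs k) (λ S → b * (coeff false S * weight ψ S))
    ≡⟨ cong₂ _+_ (sym (sumL-scaleˡ (allVecs k) a _)) (sym (sumL-scaleˡ (allVecs k) b _)) ⟩
  a * sumL (allVecs k) (λ S → coeff true S * weight ψ S) + b * sumL (allVecs k) (λ S → coeff false S * weight ψ S)
    ≡⟨ cong₂ (λ u v → a * u + b * v) (sym (apply-expansion ψ (λ x → φ (true ∷ x))))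
                                      (sym (apply-expansion ψ (λ x → φ (false ∷ x)))) ⟩
  apply ((a , b) ∷ ψ) φ ∎)
  where
  term : Bool → Subset k → ℚ
  term s S = apply (charTensor (s ∷ S)) φ * weight ((a , b) ∷ ψ) (s ∷ S)
  coeff : Bool → Subset k → ℚ
  coeff c S = apply (charTensor S) (λ x → φ (c ∷ x))
  regroup : ∀ S → term true S + term false S ≡ a * (coeff true S * weight ψ S) + b * (coeff false S * weight ψ S)
  regroup S = solve 5 (λ a b p q w → (con ½ :* p :+ con (- ½) :* q) :* ((a :- b) :* w) :+ (con ½ :* p :+ con ½ :* q) :* ((a :+ b) :* w)
                                      := a :* (p :* w) :+ b :* (q :* w))
                      refl a b (coeff true S) (coeff false S) (weight ψ S)

scale-if : ∀ d (u x y : ℚ) → u * x ≡ y → u * (if d then x else 0ℚ) ≡ (if d then y else 0ℚ)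
scale-if true  u x y e = e
scale-if false u x y e = *-zeroʳ u

weight-eval : ∀ {n} (t : ℚ) (S : Subset n) (c : Fin n → ℚ) (ψ : Vec Functional n) →
  (∀ s → lookup S s ≡ true  → total (lookup ψ s) ≡ 0ℚ × diff (lookup ψ s) ≡ c s) →
  (∀ s → lookup S s ≡ false → total (lookup ψ s) ≡ 1ℚ × diff (lookup ψ s) ≡ t) →
  ∀ S′ → weight ψ S′ ≡ (if does (S ⊆? S′) then (t ^ℚ ∣ S′ ─ S ∣) * prodOver S c else 0ℚ)
weight-eval t []      c []      on off []         = refl
weight-eval t (r ∷ S) c (ℓ ∷ ψ) on off (r′ ∷ S′) = head r r′ (on zero) (off zero)
  where
  P : ℚ
  P = prodOver S (λ s → c (suc s))
  tail-eval : weight ψ S′ ≡ (if does (S ⊆? S′) then (t ^ℚ ∣ S′ ─ S ∣) * P else 0ℚ)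
  tail-eval = weight-eval t S (λ s → c (suc s)) ψ (λ s → on (suc s)) (λ s → off (suc s)) S′
  head : ∀ r r′ → (r ≡ true → total ℓ ≡ 0ℚ × diff ℓ ≡ c zero) → (r ≡ false → total ℓ ≡ 1ℚ × diff ℓ ≡ t) →
    weight (ℓ ∷ ψ) (r′ ∷ S′)
      ≡ (if does ((r ∷ S) ⊆? (r′ ∷ S′)) then (t ^ℚ ∣ (r′ ∷ S′) ─ (r ∷ S) ∣) * prodOver (r ∷ S) c else 0ℚ)
  head true  true  on₀ off₀ = trans (cong₂ _*_ (proj₂ (on₀ refl)) tail-eval) (scale-if (does (S ⊆? S′)) (c zero) _ _
    (solve 3 (λ a b p → a :* (b :* p) := b :* (a :* p)) refl (c zero) (t ^ℚ ∣ S′ ─ S ∣) P))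
  head true  false on₀ off₀ = trans (cong (_* weight ψ S′) (proj₁ (on₀ refl))) (*-zeroˡ (weight ψ S′))
  head false true  on₀ off₀ = trans (cong₂ _*_ (proj₂ (off₀ refl)) tail-eval) (scale-if (does (S ⊆? S′)) t _ _
    (solve 3 (λ a b p → a :* (b :* p) := (a :* b) :* (con 1ℚ :* p)) refl t (t ^ℚ ∣ S′ ─ S ∣) P))
  head false false on₀ off₀ = trans (cong₂ _*_ (proj₁ (off₀ refl)) tail-eval) (scale-if (does (S ⊆? S′)) 1ℚ _ _
    (solve 2 (λ b p → con 1ℚ :* (b :* p) := b :* (con 1ℚ :* p)) refl (t ^ℚ ∣ S′ ─ S ∣) P))

Array : ℕ → ℕ → Set
Array m n = Fin m → Fin n → Bool

Extensional : ∀ {m n} → (Array m n → ℚ) → Set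
Extensional H = ∀ M M′ → (∀ i j → M i j ≡ M′ i j) → H M ≡ H M′

consColumn : ∀ {m n} → Vec Bool m → Array m n → Array m (suc n)
consColumn c M i zero    = lookup c i
consColumn c M i (suc j) = M i j

consRow : ∀ {m n} → Vec Bool n → Array m n → Array (suc m) n
consRow r N zero    j = lookup r j
consRow r N (suc i) j = N i j

applyArray : ∀ {m n} → (Fin m → Fin n → Functional) → (Array m n → ℚ) → ℚ
applyArray {m} {zero}  Φ H = H (λ i ())
applyArray {m} {suc n} Φ H =
  apply (tabulate (λ i → Φ i zero)) (λ c → applyArray (λ i j → Φ i (suc j)) (λ M → H (consColumn c M)))

applyArray-cong : ∀ {m n} (Φ : Fin m → Fin n → Functional) {H H′ : Array m n → ℚ} →
                  (∀ M → H M ≡ H′ M) → applyArray Φ H ≡ applyArray Φ H′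
applyArray-cong {m} {zero}  Φ e = e _
applyArray-cong {m} {suc n} Φ e =
  apply-cong (tabulate (λ i → Φ i zero)) (λ c → applyArray-cong (λ i j → Φ i (suc j)) (λ M → e (consColumn c M)))

applyArray-no-rows : ∀ {n} (Φ : Fin 0 → Fin n → Functional) (H : Array 0 n → ℚ) →
                     Extensional H → applyArray Φ H ≡ H (λ ())
applyArray-no-rows {zero}  Φ H ext = ext _ _ (λ ())
applyArray-no-rows {suc n} Φ H ext =
  trans (applyArray-no-rows _ (λ M → H (consColumn [] M)) (λ M M′ e → ext _ _ (λ { () })))
        (ext _ _ (λ ()))

applyArray-first-row : ∀ {k n} (Φ : Fin (suc k) → Fin n → Functional) (H : Array (suc k) n → ℚ) →
  Extensional H →
  applyArray Φ H ≡ apply (tabulate (λ j → Φ zero j)) (λ r → applyArray (λ i j → Φ (suc i) j) (λ N → H (consRow r N)))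
applyArray-first-row {k} {zero}  Φ H ext = ext _ _ (λ i ())
applyArray-first-row {k} {suc n} Φ H ext = begin
  a * apply ψ (λ x → applyArray Φ′ (λ M → H (consColumn (true ∷ x) M)))
    + b * apply ψ (λ x → applyArray Φ′ (λ M → H (consColumn (false ∷ x) M)))
    ≡⟨ cong₂ (λ u v → a * u + b * v) (apply-cong ψ (λ x → applyArray-first-row Φ′ _ (ext-column (true ∷ x))))
                                      (apply-cong ψ (λ x → applyArray-first-row Φ′ _ (ext-column (false ∷ x)))) ⟩
  a * apply ψ (λ x → apply ρ (λ r → applyArray Φ″ (λ N → H (consColumn (true ∷ x) (consRow r N)))))
    + b * apply ψ (λ x → apply ρ (λ r → applyArray Φ″ (λ N → H (consColumn (false ∷ x) (consRow r N)))))
    ≡⟨ cong₂ (λ u v → a * u + b * v) (apply-swap ψ ρ _) (apply-swap ψ ρ _) ⟩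
  a * apply ρ (λ r → apply ψ (λ x → applyArray Φ″ (λ N → H (consColumn (true ∷ x) (consRow r N)))))
    + b * apply ρ (λ r → apply ψ (λ x → applyArray Φ″ (λ N → H (consColumn (false ∷ x) (consRow r N)))))
    ≡⟨ cong₂ (λ u v → a * u + b * v) (reorder true) (reorder false) ⟩
  a * apply ρ (λ r → apply ψ (λ x → applyArray Φ″ (λ N → H (consRow (true ∷ r) (consColumn x N)))))
    + b * apply ρ (λ r → apply ψ (λ x → applyArray Φ″ (λ N → H (consRow (false ∷ r) (consColumn x N))))) ∎
  where
  a b : ℚ
  a = proj₁ (Φ zero zero)
  b = proj₂ (Φ zero zero)
  ψ : Vec Functional k
  ψ = tabulate (λ i → Φ (suc i) zero)
  ρ : Vec Functional n
  ρ = tabulate (λ j → Φ zero (suc j))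
  Φ′ : Fin (suc k) → Fin n → Functional
  Φ′ i j = Φ i (suc j)
  Φ″ : Fin k → Fin n → Functional
  Φ″ i j = Φ (suc i) (suc j)
  ext-column : ∀ c → Extensional (λ M → H (consColumn c M))
  ext-column c M M′ e = ext _ _ λ { i zero → refl ; i (suc j) → e i j }
  corner : ∀ x₀ x r (N : Array k n) i j → consColumn (x₀ ∷ x) (consRow r N) i j ≡ consRow (x₀ ∷ r) (consColumn x N) i j
  corner x₀ x r N zero    zero    = refl
  corner x₀ x r N zero    (suc j) = refl
  corner x₀ x r N (suc i) zero    = refl
  corner x₀ x r N (suc i) (suc j) = refl
  reorder : ∀ x₀ →
    apply ρ (λ r → apply ψ (λ x → applyArray Φ″ (λ N → H (consColumn (x₀ ∷ x) (consRow r N)))))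
    ≡ apply ρ (λ r → apply ψ (λ x → applyArray Φ″ (λ N → H (consRow (x₀ ∷ r) (consColumn x N)))))
  reorder x₀ = apply-cong ρ (λ r → apply-cong ψ (λ x → applyArray-cong Φ″ (λ N → ext _ _ (corner x₀ x r N))))

applyArray-transpose : ∀ {m n} (Φ : Fin m → Fin n → Functional) (H : Array m n → ℚ) → Extensional H →
  applyArray Φ H ≡ applyArray (λ j i → Φ i j) (λ N → H (λ i j → N j i))
applyArray-transpose {m} {zero}  Φ H ext =
  sym (trans (applyArray-no-rows _ _ (λ M M′ e → ext _ _ (λ i j → e j i))) (ext _ _ (λ i ())))
applyArray-transpose {m} {suc n} Φ H ext = begin
  apply ψ (λ c → applyArray Φ′ (λ M → H (consColumn c M)))
    ≡⟨ apply-cong ψ (λ c → applyArray-transpose Φ′ _ (λ M M′ e → ext _ _ (λ { i zero → refl ; i (suc j) → e i j }))) ⟩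
  apply ψ (λ c → applyArray (λ j i → Φ′ i j) (λ N → H (consColumn c (λ i j → N j i))))
    ≡⟨ apply-cong ψ (λ c → applyArray-cong (λ j i → Φ′ i j)
         (λ N → ext (consColumn c (λ i j → N j i)) (λ i j → consRow c N j i) (λ { i zero → refl ; i (suc j) → refl }))) ⟩
  apply ψ (λ r → applyArray (λ j i → Φ′ i j) (λ N → H (λ i j → consRow r N j i)))
    ≡⟨ sym (applyArray-first-row (λ j i → Φ i j) (λ N → H (λ i j → N j i)) (λ M M′ e → ext _ _ (λ i j → e j i))) ⟩
  applyArray (λ j i → Φ i j) (λ N → H (λ i j → N j i)) ∎
  where
  ψ : Vec Functional m
  ψ = tabulate (λ i → Φ i zero)
  Φ′ : Fin m → Fin n → Functional
  Φ′ i j = Φ i (suc j)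

-- A function of the single bit h(x) only sees two numbers of a tensor ψ:
-- its total mass ψ(1) and ψ(val ∘ h).
pushforward : ∀ {k} → BFun k → Vec Functional k → Functional
pushforward h ψ = ½ * (apply ψ (λ _ → 1ℚ) + apply ψ (λ x → val (h x)))
                , ½ * (apply ψ (λ _ → 1ℚ) - apply ψ (λ x → val (h x)))

total-pushforward : ∀ {k} (h : BFun k) (ψ : Vec Functional k) → total (pushforward h ψ) ≡ apply ψ (λ _ → 1ℚ)
total-pushforward h ψ = solve 2 (λ p q → con ½ :* (p :+ q) :+ con ½ :* (p :- q) := p)
                              refl (apply ψ (λ _ → 1ℚ)) (apply ψ (λ x → val (h x)))

diff-pushforward : ∀ {k} (h : BFun k) (ψ : Vec Functional k) → diff (pushforward h ψ) ≡ apply ψ (λ x → val (h x))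
diff-pushforward h ψ = solve 2 (λ p q → con ½ :* (p :+ q) :- con ½ :* (p :- q) := q)
                             refl (apply ψ (λ _ → 1ℚ)) (apply ψ (λ x → val (h x)))

-- Change of variables: ψ(φ ∘ h) = (pushforward h ψ)(φ).  Every φ : Bool → ℚ
-- is affine in val, φ(b) = ½(φT + φF) + ½(φT − φF)·val b.
apply-pushforward : ∀ {k} (h : BFun k) (ψ : Vec Functional k) (φ : Bool → ℚ) →
                    apply ψ (λ x → φ (h x)) ≡ apply₁ (pushforward h ψ) φ
apply-pushforward h ψ φ = begin
  apply ψ (λ x → φ (h x))
    ≡⟨ apply-cong ψ (λ x → affine (h x)) ⟩
  apply ψ (λ x → A * 1ℚ + D * val (h x))
    ≡⟨ apply-+ ψ (λ _ → A * 1ℚ) (λ x → D * val (h x)) ⟩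
  apply ψ (λ _ → A * 1ℚ) + apply ψ (λ x → D * val (h x))
    ≡⟨ cong₂ _+_ (apply-scale ψ A (λ _ → 1ℚ)) (apply-scale ψ D (λ x → val (h x))) ⟩
  A * apply ψ (λ _ → 1ℚ) + D * apply ψ (λ x → val (h x))
    ≡⟨ solve 4 (λ p q e G → (con ½ :* (p :+ q)) :* e :+ (con ½ :* (p :- q)) :* G
                 := (con ½ :* (e :+ G)) :* p :+ (con ½ :* (e :- G)) :* q)
             refl (φ true) (φ false) (apply ψ (λ _ → 1ℚ)) (apply ψ (λ x → val (h x))) ⟩
  apply₁ (pushforward h ψ) φ ∎
  where
  A D : ℚ
  A = ½ * (φ true + φ false)
  D = ½ * (φ true - φ false)
  affine : ∀ b → φ b ≡ A * 1ℚ + D * val b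
  affine true  = solve 2 (λ p q → p := (con ½ :* (p :+ q)) :* con 1ℚ :+ (con ½ :* (p :- q)) :* con 1ℚ)
                       refl (φ true) (φ false)
  affine false = solve 2 (λ p q → q := (con ½ :* (p :+ q)) :* con 1ℚ :+ (con ½ :* (p :- q)) :* con (- 1ℚ))
                       refl (φ true) (φ false)

applyArray-columns : ∀ {m n} (g : BFun m) (Φ : Fin m → Fin n → Functional) (φ : Input n → ℚ) →
  applyArray Φ (λ M → φ (tabulate (λ j → g (tabulate (λ i → M i j)))))
  ≡ apply (tabulate (λ j → pushforward g (tabulate (λ i → Φ i j)))) φ
applyArray-columns {m} {zero}  g Φ φ = refl
applyArray-columns {m} {suc n} g Φ φ = begin
  apply ψ (λ c → applyArray Φ′ (λ M → φ (g (tabulate (lookup c)) ∷ tabulate (λ j → g (tabulate (λ i → M i j))))))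
    ≡⟨ apply-cong ψ (λ c → applyArray-columns g Φ′ (λ v → φ (g (tabulate (lookup c)) ∷ v))) ⟩
  apply ψ (λ c → apply ρ (λ v → φ (g (tabulate (lookup c)) ∷ v)))
    ≡⟨ apply-swap ψ ρ (λ c v → φ (g (tabulate (lookup c)) ∷ v)) ⟩
  apply ρ (λ v → apply ψ (λ c → φ (g (tabulate (lookup c)) ∷ v)))
    ≡⟨ apply-cong ρ (λ v → trans (apply-cong ψ (λ c → cong (λ w → φ (g w ∷ v)) (tabulate∘lookup c)))
                                 (apply-pushforward g ψ (λ b → φ (b ∷ v)))) ⟩
  apply ρ (λ v → apply₁ (pushforward g ψ) (λ b → φ (b ∷ v)))
    ≡⟨ sym (apply-swap (pushforward g ψ ∷ []) ρ (λ x v → φ (Vec.head x ∷ v))) ⟩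
  apply (pushforward g ψ ∷ ρ) φ ∎
  where
  ψ : Vec Functional m
  ψ = tabulate (λ i → Φ i zero)
  Φ′ : Fin m → Fin n → Functional
  Φ′ i j = Φ i (suc j)
  ρ : Vec Functional n
  ρ = tabulate (λ j → pushforward g (tabulate (λ i → Φ′ i j)))

charTensor-mass-⊥ : ∀ k → apply (charTensor (⊥ {k})) (λ _ → 1ℚ) ≡ 1ℚ
charTensor-mass-⊥ zero    = refl
charTensor-mass-⊥ (suc k) = trans (cong (λ u → ½ * u + ½ * u) (charTensor-mass-⊥ k))
                                  (solve 0 (con ½ :* con 1ℚ :+ con ½ :* con 1ℚ := con 1ℚ) refl)

charTensor-mass-nonempty : ∀ {k} (p : Fin k → Bool) → anyFin k p ≡ true →
                           apply (charTensor (tabulate p)) (λ _ → 1ℚ) ≡ 0ℚ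
charTensor-mass-nonempty {zero}  p ()
charTensor-mass-nonempty {suc k} p some with p zero
... | true  = solve 1 (λ u → con ½ :* u :+ con (- ½) :* u := con 0ℚ) refl
                    (apply (charTensor (tabulate (λ i → p (suc i)))) (λ _ → 1ℚ))
... | false = trans (cong (λ u → ½ * u + ½ * u) (charTensor-mass-nonempty (λ i → p (suc i)) some))
                    (solve 0 (con ½ :* con 0ℚ :+ con ½ :* con 0ℚ := con 0ℚ) refl)

none⇒⊥ : ∀ {k} (p : Fin k → Bool) → anyFin k p ≡ false → tabulate p ≡ ⊥
none⇒⊥ {zero}  p none = refl
none⇒⊥ {suc k} p none with p zero
... | false = cong (false ∷_) (none⇒⊥ (λ i → p (suc i)) none)

arrayOf : ∀ {m n} → (Fin m → Fin n → Bool) → Fin m → Fin n → Functional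
arrayOf U r s = charFunctional (U r s)

collapsed : ∀ {m n} → BFun m → (Fin m → Fin n → Bool) → Vec Functional n
collapsed g U = tabulate (λ s → pushforward g (tabulate (λ r → arrayOf U r s)))

collapsed-total : ∀ {m n} (g : BFun m) (U : Fin m → Fin n → Bool) (s : Fin n) →
  total (lookup (collapsed g U) s) ≡ apply (charTensor (Xcol U s)) (λ _ → 1ℚ)
collapsed-total g U s = begin
  total (lookup (collapsed g U) s)
    ≡⟨ cong total (lookup∘tabulate (λ s → pushforward g (tabulate (λ r → arrayOf U r s))) s) ⟩
  total (pushforward g (tabulate (λ r → arrayOf U r s)))
    ≡⟨ total-pushforward g (tabulate (λ r → arrayOf U r s)) ⟩
  apply (tabulate (λ r → charFunctional (U r s))) (λ _ → 1ℚ)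
    ≡⟨ cong (λ ψ → apply ψ (λ _ → 1ℚ)) (tabulate-∘ charFunctional (λ r → U r s)) ⟩
  apply (charTensor (Xcol U s)) (λ _ → 1ℚ) ∎

collapsed-diff : ∀ {m n} (g : BFun m) (U : Fin m → Fin n → Bool) (s : Fin n) →
  diff (lookup (collapsed g U) s) ≡ fourier g (Xcol U s)
collapsed-diff g U s = begin
  diff (lookup (collapsed g U) s)
    ≡⟨ cong diff (lookup∘tabulate (λ s → pushforward g (tabulate (λ r → arrayOf U r s))) s) ⟩
  diff (pushforward g (tabulate (λ r → arrayOf U r s)))
    ≡⟨ diff-pushforward g (tabulate (λ r → arrayOf U r s)) ⟩
  apply (tabulate (λ r → charFunctional (U r s))) (λ x → val (g x))
    ≡⟨ cong (λ ψ → apply ψ (λ x → val (g x))) (tabulate-∘ charFunctional (λ r → U r s)) ⟩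
  apply (charTensor (Xcol U s)) (λ x → val (g x))
    ≡⟨ sym (fourier-apply g (Xcol U s)) ⟩
  fourier g (Xcol U s) ∎

collapsed-in-SU : ∀ {m n} (g : BFun m) (U : Fin m → Fin n → Bool) (s : Fin n) → lookup (SU U) s ≡ true →
  total (lookup (collapsed g U) s) ≡ 0ℚ × diff (lookup (collapsed g U) s) ≡ fourier g (Xcol U s)
collapsed-in-SU {m} g U s s∈SU =
  trans (collapsed-total g U s)
        (charTensor-mass-nonempty (λ r → U r s) (trans (sym (lookup∘tabulate (λ s → anyFin m (λ r → U r s)) s)) s∈SU))
  , collapsed-diff g U s

collapsed-out-SU : ∀ {m n} (g : BFun m) (U : Fin m → Fin n → Bool) (s : Fin n) → lookup (SU U) s ≡ false →
  total (lookup (collapsed g U) s) ≡ 1ℚ × diff (lookup (collapsed g U) s) ≡ fourier g ⊥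
collapsed-out-SU {m} g U s s∉SU =
  trans (collapsed-total g U s) (trans (cong (λ X → apply (charTensor X) (λ _ → 1ℚ)) Xs≡⊥) (charTensor-mass-⊥ m))
  , trans (collapsed-diff g U s) (cong (fourier g) Xs≡⊥)
  where
  Xs≡⊥ : Xcol U s ≡ ⊥
  Xs≡⊥ = none⇒⊥ (λ r → U r s) (trans (sym (lookup∘tabulate (λ s → anyFin m (λ r → U r s)) s)) s∉SU)

columnsThen : ∀ {m n} → BFun m → BFun n → Array m n → Bool
columnsThen g f M = f (tabulate (λ j → g (tabulate (λ i → M i j))))

columnsThen-ext : ∀ {m n} (g : BFun m) (f : BFun n) → Extensional (λ M → val (columnsThen g f M))
columnsThen-ext g f M M′ e = cong (λ v → val (f v)) (tabulate-cong (λ j → cong g (tabulate-cong (λ i → e i j))))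

array-side : ∀ {m n} (g : BFun m) (f : BFun n) (U : Fin m → Fin n → Bool) →
  sumSupersets (SU U) (λ S′ → fourier f S′ * (fourier g ⊥ ^ℚ ∣ S′ ─ SU U ∣))
    * prodOver (SU U) (λ s → fourier g (Xcol U s))
  ≡ applyArray (arrayOf U) (λ M → val (columnsThen g f M))
array-side {m} {n} g f U = begin
  sumL (allVecs n) (λ S′ → if does (S ⊆? S′) then F S′ else 0ℚ) * P
    ≡⟨ sumL-scaleʳ (allVecs n) P (λ S′ → if does (S ⊆? S′) then F S′ else 0ℚ) ⟩
  sumL (allVecs n) (λ S′ → (if does (S ⊆? S′) then F S′ else 0ℚ) * P)
    ≡⟨ sumL-cong (allVecs n) term ⟩
  sumL (allVecs n) (λ S′ → apply (charTensor S′) φ * weight (collapsed g U) S′)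
    ≡⟨ sym (apply-expansion (collapsed g U) φ) ⟩
  apply (collapsed g U) φ
    ≡⟨ sym (applyArray-columns g (arrayOf U) φ) ⟩
  applyArray (arrayOf U) (λ M → val (columnsThen g f M)) ∎
  where
  S : Subset n
  S = SU U
  t P : ℚ
  t = fourier g ⊥
  P = prodOver S (λ s → fourier g (Xcol U s))
  F : Subset n → ℚ
  F S′ = fourier f S′ * (t ^ℚ ∣ S′ ─ S ∣)
  φ : Input n → ℚ
  φ x = val (f x)
  regroup : ∀ S′ d → fourier f S′ * (if d then (t ^ℚ ∣ S′ ─ S ∣) * P else 0ℚ) ≡ (if d then F S′ else 0ℚ) * P
  regroup S′ true  = sym (*-assoc (fourier f S′) (t ^ℚ ∣ S′ ─ S ∣) P)
  regroup S′ false = trans (*-zeroʳ (fourier f S′)) (sym (*-zeroˡ P))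
  term : ∀ S′ → (if does (S ⊆? S′) then F S′ else 0ℚ) * P ≡ apply (charTensor S′) φ * weight (collapsed g U) S′
  term S′ = sym (trans
    (cong₂ _*_ (sym (fourier-apply f S′))
               (weight-eval t S (λ s → fourier g (Xcol U s)) (collapsed g U) (collapsed-in-SU g U) (collapsed-out-SU g U) S′))
    (regroup S′ (does (S ⊆? S′))))

-- Lemma 4.1.  Both sides are the array functional of U applied to
-- f ∘ (g on columns), resp. g ∘ (f on rows), which agree by commutation;
-- of the normal-pair axioms only commutation is needed.
lemma4p1 : {m n : ℕ} (g : BFun m) (f : BFun n) → NormalPair g f →
    (U : Fin m → Fin n → Bool) →
    sumSupersets (SU U) (λ S′ → fourier f S′ * (fourier g ⊥ ^ℚ ∣ S′ ─ SU U ∣))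
      * prodOver (SU U) (λ s → fourier g (Xcol U s))
    ≡ sumSupersets (RU U) (λ R′ → fourier g R′ * (fourier f ⊥ ^ℚ ∣ R′ ─ RU U ∣))
      * prodOver (RU U) (λ r → fourier f (Yrow U r))
lemma4p1 {m} {n} g f normal U = begin
  _ ≡⟨ array-side g f U ⟩
  applyArray (arrayOf U) (λ M → val (columnsThen g f M))
    ≡⟨ applyArray-transpose (arrayOf U) (λ M → val (columnsThen g f M)) (columnsThen-ext g f) ⟩
  applyArray (arrayOf Uᵀ) (λ N → val (columnsThen g f (λ i j → N j i)))
    ≡⟨ applyArray-cong (arrayOf Uᵀ) (λ N → cong val (NormalPair.commute normal (λ i j → N j i))) ⟩
  applyArray (arrayOf Uᵀ) (λ N → val (columnsThen f g N))
    ≡⟨ sym (array-side f g Uᵀ) ⟩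
  _ ∎
  where
  Uᵀ : Fin n → Fin m → Bool
  Uᵀ s r = U r s
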